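{- For all integers $\ell \geq 3$ and $n \geq 1$, $$\ell n - 2\ell - 1 \leq f_\ell(n,1) \leq \ell n - \ell + 1.$$
   Context: $f_\ell(n,1)$ denotes the clique number of the xor-product of $\ell$ copies of the complete graph $K_n$. The xor-product $G_1 \cdots G_\ell$ of graphs has vertex set $V(G_1)\times\cdots\times V(G_\ell)$, and two distinct vertices $(g_1,\dots,g_\ell)$, $(g_1',\dots,g_\ell')$ are adjacent iff $g_ig_i'\in E(G_i)$ for an odd number of indices $i$ (in $K_n$, $g_ig_i'$ is an edge iff $g_i\neq g_i'$). -}

module Defs where

open import Data.Nat using (ℕ; zero; suc; _+_; _*_; _≤_)
open import Data.Nat.Properties using ()
open import Data.Fin using (Fin)
open import Data.Fin.Properties using (_≟_)
open import Data.Vec using (Vec; []; _∷_)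
open import Data.List using (List; length)
open import Data.List.Relation.Unary.AllPairs using (AllPairs)
open import Data.Product using (_×_; ∃)
open import Relation.Nullary using (¬_; yes; no)
open import Relation.Binary.PropositionalEquality using (_≡_)

Vertex : ℕ → ℕ → Set
Vertex ℓ n = Vec (Fin n) ℓ

diffCount : ∀ {ℓ n} → Vertex ℓ n → Vertex ℓ n → ℕ
diffCount [] [] = 0
diffCount (x ∷ xs) (y ∷ ys) with x ≟ y
... | yes _ = diffCount xs ys
... | no  _ = suc (diffCount xs ys)

data Odd : ℕ → Set where
  one  : Odd 1
  s-s  : ∀ {k} → Odd k → Odd (suc (suc k))

-- adjacency in the xor-product K_n ⋯ K_n (ℓ factors): distinct and an odd
-- number of coordinates adjacent in K_n
Adj : ∀ {ℓ n} → Vertex ℓ n → Vertex ℓ n → Set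
Adj u v = ¬ (u ≡ v) × Odd (diffCount u v)

IsClique : ∀ {ℓ n} → List (Vertex ℓ n) → Set
IsClique = AllPairs Adj

IsCliqueNumber : ℕ → ℕ → ℕ → Set
IsCliqueNumber ℓ n k =
  (∃ λ (C : List (Vertex ℓ n)) → IsClique C × length C ≡ k)
  × (∀ (C : List (Vertex ℓ n)) → IsClique C → length C ≤ k)

-- Over GF(2) send a vertex u of the ℓ-fold xor-product of K_(m+1) to vectors Z u and
-- W u of length 1 + ℓm.  In each coordinate Z uses the indicator of x among the nonzero values, and
-- W the indicator of y, or the all-ones vector when y = 0, so that the block product is
-- [x = y] + [y = 0]; an extra first coordinate absorbs the constant terms, leaving
-- Z u · W v = 1 + (parity of the number of coordinates where u and v differ).  On a clique the
-- matrix (Z a · W b) is therefore the identity, so the Z a are linearly independent and there are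
-- at most 1 + ℓm of them.
--
-- Lower bound, for n = m + 3.  A line varies one coordinate over the m + 1 values ≥ 2 and fixes
-- the others in {0, 1}; it is a clique.  The lines through (·,0,0), (0,·,1), (1,1,·) (a tripod),
-- and those through (·,1,0,0), (0,·,1,0), (1,0,·,0), (1,1,1,·) (a tetrapod), are pairwise at
-- distance 3, giving cliques of size 3(m+1) and 4(m+1).  Cliques glue along centres: if every
-- member of a clique C is at distance of parity σ from t, and K is a clique with points z, z′ at
-- distance parity 1 + σ resp. σ from all of K and at even distance from each other, then
-- (z ++ C) ∪ (K ++ t) is a clique, centred at z′ ++ t with parity σ.  The tetrapod, with z and z′
-- among 0000 and 1111, can be glued onto any centred clique; so can the tripod minus (2,0,0), with
-- z and z′ among (2,0,0) and (0,1,0), at the cost of one vertex.  Starting from the tripod, the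
-- tetrapod, the tetrapod glued onto the m + 2 nonzero values of one coordinate, and two glued
-- tripods, this yields cliques of size ℓ(m+1) − 1 for every ℓ ≥ 3.
module Submission where

open import Defs
open import Algebra.Solver.Ring.AlmostCommutativeRing using (fromCommutativeRing)
import Algebra.Solver.Ring.Simple as RingSolver
open import Data.Fin using (Fin; zero; suc; combine; remQuot; _↑ʳ_)
open import Data.Fin.Patterns using (0F; 1F; 2F; 3F)
open import Data.Fin.Properties
  using (_≟_; any?; suc-injective; ↑ʳ-injective; remQuot-combine; combine-remQuot; injective⇒≤)
open import Data.List using (List; []; _∷_; length)
import Data.List as List
open import Data.List.Properties using (length-++; length-map; length-tabulate)
open import Data.List.Relation.Unary.All using (All; []; _∷_)
import Data.List.Relation.Unary.All as All
import Data.List.Relation.Unary.All.Properties as All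
open import Data.List.Relation.Unary.AllPairs using (AllPairs; []; _∷_; allPairs?)
import Data.List.Relation.Unary.AllPairs as AllPairs
import Data.List.Relation.Unary.AllPairs.Properties as AllPairs
open import Data.Nat using (ℕ; zero; suc; _+_; _*_; _^_; _≤_; z≤n; s≤s; parity)
open import Data.Nat.Properties
  using ( ≤-trans; ≤-reflexive; n≤1+n; m≤m+n; m≤n+m; ≤∧≢⇒<; m<1+n⇒m≤n; ≮⇒≥; <⇒≱; +-comm
        ; +-identityʳ; *-comm; *-distribʳ-+; +-mono-≤; +-monoˡ-≤; +-monoʳ-≤; *-monoʳ-≤; ^-monoʳ-<
        ; module ≤-Reasoning )
open import Data.Nat.Tactic.RingSolver using (solve-∀)
open import Data.Parity using (Parity; 0ℙ; 1ℙ; _⁻¹)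
import Data.Parity as ℙ
import Data.Parity.Properties as ℙ
open import Data.Product using (_×_; _,_; ∃; proj₁; proj₂)
open import Data.Vec using (Vec; []; _∷_; _++_; replicate; zipWith; map; lookup; _[_]≔_; insertAt; toList; fromList)
open import Data.Vec.Properties
  using (≡-dec; ∷-injective; lookup∘update; lookup∘update′; lookup-replicate; length-toList; toList∘fromList)
open import Function using (_∘_; case_of_; Injective; _↔_; mk↔ₛ′; _↣_; mk↣; Injection)
open import Function.Construct.Composition using (_↣-∘_)
open import Function.Properties.Inverse using (↔⇒↣; ↔-sym)
open import Relation.Binary.PropositionalEquality
open import Relation.Nullary using (Dec; yes; no; contradiction)
open import Relation.Nullary.Decidable using (map′; ¬?; _×-dec_)
open import Relation.Unary using (Decidable)

private variable
  k ℓ n : ℕ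

-- Parity and Hamming distance

Odd⇒parity≡1ℙ : ∀ {d} → Odd d → parity d ≡ 1ℙ
Odd⇒parity≡1ℙ one = refl
Odd⇒parity≡1ℙ (s-s odd) = Odd⇒parity≡1ℙ odd

parity≡1ℙ⇒Odd : ∀ d → parity d ≡ 1ℙ → Odd d
parity≡1ℙ⇒Odd (suc zero) _ = one
parity≡1ℙ⇒Odd (suc (suc d)) eq = s-s (parity≡1ℙ⇒Odd d eq)

odd? : Decidable Odd
odd? d = map′ (parity≡1ℙ⇒Odd d) Odd⇒parity≡1ℙ (parity d ℙ.≟ 1ℙ)

diffCount-refl : (u : Vertex ℓ n) → diffCount u u ≡ 0
diffCount-refl [] = refl
diffCount-refl (x ∷ u) with x ≟ x
... | yes _ = diffCount-refl u
... | no x≢x = contradiction refl x≢x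

diffCount-sym : (u v : Vertex ℓ n) → diffCount u v ≡ diffCount v u
diffCount-sym [] [] = refl
diffCount-sym (x ∷ u) (y ∷ v) with x ≟ y | y ≟ x
... | yes _   | yes _   = diffCount-sym u v
... | yes x≡y | no y≢x  = contradiction (sym x≡y) y≢x
... | no x≢y  | yes y≡x = contradiction (sym y≡x) x≢y
... | no _    | no _    = cong suc (diffCount-sym u v)

diffCount-++ : (u u′ : Vertex k n) (v v′ : Vertex ℓ n) →
               diffCount (u ++ v) (u′ ++ v′) ≡ diffCount u u′ + diffCount v v′
diffCount-++ [] [] v v′ = refl
diffCount-++ (x ∷ u) (x′ ∷ u′) v v′ with x ≟ x′
... | yes _ = diffCount-++ u u′ v v′
... | no _  = cong suc (diffCount-++ u u′ v v′)

diffCount-insertAt : (u : Vertex ℓ n) (i : Fin (suc ℓ)) {x y : Fin n} → x ≢ y →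
                     diffCount (insertAt u i x) (insertAt u i y) ≡ 1
diffCount-insertAt u zero {x} {y} x≢y with x ≟ y
... | yes x≡y = contradiction x≡y x≢y
... | no _    = cong suc (diffCount-refl u)
diffCount-insertAt (w ∷ u) (suc i) x≢y with w ≟ w
... | yes _  = diffCount-insertAt u i x≢y
... | no w≢w = contradiction refl w≢w

Odd⇒Adj : {u v : Vertex ℓ n} → Odd (diffCount u v) → Adj u v
Odd⇒Adj {u = u} odd = (λ { refl → case subst Odd (diffCount-refl u) odd of λ () }) , odd

adj? : (u v : Vertex ℓ n) → Dec (Adj u v)
adj? u v = ¬? (≡-dec _≟_ u v) ×-dec odd? (diffCount u v)

diffParity : Vertex ℓ n → Vertex ℓ n → Parity
diffParity u v = parity (diffCount u v)

diffParity-refl : (u : Vertex ℓ n) → diffParity u u ≡ 0ℙ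
diffParity-refl u = cong parity (diffCount-refl u)

diffParity-sym : (u v : Vertex ℓ n) → diffParity u v ≡ diffParity v u
diffParity-sym u v = cong parity (diffCount-sym u v)

diffParity-++ : (u u′ : Vertex k n) (v v′ : Vertex ℓ n) →
                diffParity (u ++ v) (u′ ++ v′) ≡ diffParity u u′ ℙ.+ diffParity v v′
diffParity-++ u u′ v v′ =
  trans (cong parity (diffCount-++ u u′ v v′)) (ℙ.+-homo-+ (diffCount u u′) (diffCount v v′))

Adj⇒diffParity≡1ℙ : {u v : Vertex ℓ n} → Adj u v → diffParity u v ≡ 1ℙ
Adj⇒diffParity≡1ℙ (_ , odd) = Odd⇒parity≡1ℙ odd

diffParity≡1ℙ⇒Adj : {u v : Vertex ℓ n} → diffParity u v ≡ 1ℙ → Adj u v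
diffParity≡1ℙ⇒Adj {u = u} {v} eq = Odd⇒Adj (parity≡1ℙ⇒Odd (diffCount u v) eq)

-- Existence of the clique number

Searchable : Set → Set₁
Searchable A = ∀ {P : A → Set} → Decidable P → Dec (∃ P)

Vec-searchable : {A : Set} → Searchable A → ∀ k → Searchable (Vec A k)
Vec-searchable search zero P? = map′ ([] ,_) (λ { ([] , p) → p }) (P? [])
Vec-searchable search (suc k) P? =
  map′ (λ (x , xs , p) → x ∷ xs , p) (λ { (x ∷ xs , p) → x , xs , p })
       (search (λ x → Vec-searchable search k (λ xs → P? (x ∷ xs))))

bounded-maximum : {Q : ℕ → Set} → Decidable Q → Q 0 → ∀ N → (∀ {j} → Q j → j ≤ N) →
                  ∃ λ k → Q k × (∀ {j} → Q j → j ≤ k)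
bounded-maximum Q? q₀ zero bound = 0 , q₀ , bound
bounded-maximum Q? q₀ (suc N) bound with Q? (suc N)
... | yes q = suc N , q , bound
... | no ¬q = bounded-maximum Q? q₀ N λ q → m<1+n⇒m≤n (≤∧≢⇒< (bound q) λ { refl → ¬q q })

HasCliqueOfSize : ℕ → ℕ → ℕ → Set
HasCliqueOfSize ℓ n j = ∃ λ (v : Vec (Vertex ℓ n) j) → IsClique (toList v)

hasCliqueOfSize? : ∀ ℓ n → Decidable (HasCliqueOfSize ℓ n)
hasCliqueOfSize? ℓ n j = Vec-searchable (Vec-searchable any? ℓ) j (λ v → allPairs? adj? (toList v))

clique-number-exists : ∀ ℓ n N → (∀ C → IsClique C → length C ≤ N) → ∃ (IsCliqueNumber ℓ n)
clique-number-exists ℓ n N bound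
  with k , (v , clique) , maximal ← bounded-maximum (hasCliqueOfSize? ℓ n) ([] , []) N
         (λ (v , clique) → subst (_≤ N) (length-toList v) (bound _ clique))
  = k , (toList v , clique , length-toList v)
      , λ C clique → maximal (fromList C , subst IsClique (sym (toList∘fromList C)) clique)

-- Linear algebra over GF(2)

module ℙ-Solver = RingSolver (fromCommutativeRing ℙ.+-*-commutativeRing) ℙ._≟_
open ℙ-Solver using (solve; _:=_; _:+_; _:*_; con)

infixr 10 _⊛_
infixl 9 _⊕_
infix  8 _·_

_·_ : Vec Parity k → Vec Parity k → Parity
[] · [] = 0ℙ
(x ∷ u) · (y ∷ v) = x ℙ.* y ℙ.+ u · v

_⊕_ : Vec Parity k → Vec Parity k → Vec Parity k
_⊕_ = zipWith ℙ._+_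

_⊛_ : Parity → Vec Parity k → Vec Parity k
c ⊛ u = map (c ℙ.*_) u

·-zeroˡ : (u : Vec Parity k) → replicate k 0ℙ · u ≡ 0ℙ
·-zeroˡ [] = refl
·-zeroˡ (_ ∷ u) = ·-zeroˡ u

·-++ : (u u′ : Vec Parity k) (v v′ : Vec Parity ℓ) → (u ++ v) · (u′ ++ v′) ≡ u · u′ ℙ.+ v · v′
·-++ [] [] v v′ = refl
·-++ (x ∷ u) (x′ ∷ u′) v v′ =
  trans (cong (x ℙ.* x′ ℙ.+_) (·-++ u u′ v v′)) (sym (ℙ.+-assoc (x ℙ.* x′) (u · u′) (v · v′)))

·-⊛-⊕ : ∀ c (u v w : Vec Parity k) → c ⊛ u ⊕ v · w ≡ c ℙ.* (u · w) ℙ.+ v · w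
·-⊛-⊕ c [] [] [] = sym (trans (ℙ.+-identityʳ _) (ℙ.*-zeroʳ c))
·-⊛-⊕ c (x ∷ u) (y ∷ v) (z ∷ w) =
  trans (cong ((c ℙ.* x ℙ.+ y) ℙ.* z ℙ.+_) (·-⊛-⊕ c u v w))
        (solve 6 (λ c x y z a b → (c :* x :+ y) :* z :+ (c :* a :+ b) := c :* (x :* z :+ a) :+ (y :* z :+ b))
               refl c x y z (u · w) (v · w))

⊕-cancelˡ : (u v w : Vec Parity k) → u ⊕ v ≡ u ⊕ w → v ≡ w
⊕-cancelˡ [] [] [] _ = refl
⊕-cancelˡ (x ∷ u) (y ∷ v) (z ∷ w) eq with head-eq , tail-eq ← ∷-injective eq =
  cong₂ _∷_ (ℙ.+-cancelˡ-≡ x y z head-eq) (⊕-cancelˡ u v w tail-eq)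

Vec-Parity↔Fin : Vec Parity k ↔ Fin (2 ^ k)
Vec-Parity↔Fin {k} = mk↔ₛ′ toFin (fromFin k) (toFin-fromFin k) fromFin-toFin
  where
  bit : Parity → Fin 2
  bit 0ℙ = 0F
  bit 1ℙ = 1F

  unbit : Fin 2 → Parity
  unbit 0F = 0ℙ
  unbit 1F = 1ℙ

  toFin : ∀ {d} → Vec Parity d → Fin (2 ^ d)
  toFin [] = zero
  toFin (p ∷ v) = combine (bit p) (toFin v)

  fromFin : ∀ d → Fin (2 ^ d) → Vec Parity d
  fromFin zero _ = []
  fromFin (suc d) i = unbit (proj₁ (remQuot (2 ^ d) i)) ∷ fromFin d (proj₂ (remQuot (2 ^ d) i))

  toFin-fromFin : ∀ d (i : Fin (2 ^ d)) → toFin (fromFin d i) ≡ i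
  toFin-fromFin zero zero = refl
  toFin-fromFin (suc d) i =
    trans (cong₂ combine (bit-unbit (proj₁ (remQuot (2 ^ d) i))) (toFin-fromFin d (proj₂ (remQuot (2 ^ d) i))))
          (combine-remQuot {2} (2 ^ d) i)
    where
    bit-unbit : ∀ b → bit (unbit b) ≡ b
    bit-unbit 0F = refl
    bit-unbit 1F = refl

  fromFin-toFin : ∀ {d} (v : Vec Parity d) → fromFin d (toFin v) ≡ v
  fromFin-toFin [] = refl
  fromFin-toFin {suc d} (p ∷ v) =
    cong₂ _∷_ (trans (cong (unbit ∘ proj₁) split) (unbit-bit p))
              (trans (cong (fromFin d ∘ proj₂) split) (fromFin-toFin v))
    where
    split : remQuot (2 ^ d) (combine (bit p) (toFin v)) ≡ (bit p , toFin v)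
    split = remQuot-combine (bit p) (toFin v)

    unbit-bit : ∀ p → unbit (bit p) ≡ p
    unbit-bit 0ℙ = refl
    unbit-bit 1ℙ = refl

Vec-Parity-↣⇒≤ : Vec Parity k ↣ Vec Parity ℓ → k ≤ ℓ
Vec-Parity-↣⇒≤ {k} {ℓ} f = ≮⇒≥ λ ℓ<k →
  <⇒≱ (^-monoʳ-< 2 (s≤s (s≤s z≤n)) ℓ<k) (injective⇒≤ {f = Injection.to g} (Injection.injective g))
  where
  g : Fin (2 ^ k) ↣ Fin (2 ^ ℓ)
  g = ↔⇒↣ Vec-Parity↔Fin ↣-∘ (f ↣-∘ ↔⇒↣ (↔-sym Vec-Parity↔Fin))

module _ {A : Set} {D : ℕ} (Z W : A → Vec Parity D) where

  combination : (C : List A) → Vec Parity (length C) → Vec Parity D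
  combination [] [] = replicate D 0ℙ
  combination (a ∷ C) (c ∷ cs) = c ⊛ Z a ⊕ combination C cs

  combination-·-orthogonal : ∀ {a} C → All (λ b → Z b · W a ≡ 0ℙ) C → ∀ cs → combination C cs · W a ≡ 0ℙ
  combination-·-orthogonal {a} [] [] [] = ·-zeroˡ (W a)
  combination-·-orthogonal {a} (b ∷ C) (o ∷ os) (c ∷ cs) = begin
    c ⊛ Z b ⊕ combination C cs · W a             ≡⟨ ·-⊛-⊕ c (Z b) _ (W a) ⟩
    c ℙ.* (Z b · W a) ℙ.+ combination C cs · W a ≡⟨ cong₂ (λ x y → c ℙ.* x ℙ.+ y) o (combination-·-orthogonal C os cs) ⟩
    c ℙ.* 0ℙ ℙ.+ 0ℙ                              ≡⟨ cong (ℙ._+ 0ℙ) (ℙ.*-zeroʳ c) ⟩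
    0ℙ                                           ∎
    where open ≡-Reasoning

  combination-injective : ∀ C → All (λ a → Z a · W a ≡ 1ℙ) C → AllPairs (λ a b → Z b · W a ≡ 0ℙ) C →
                          Injective _≡_ _≡_ (combination C)
  combination-injective [] [] [] {[]} {[]} _ = refl
  combination-injective (a ∷ C) (d ∷ ds) (o ∷ os) {c ∷ cs} {c′ ∷ cs′} eq =
    cong₂ _∷_ c≡c′ (combination-injective C ds os (⊕-cancelˡ (c ⊛ Z a) _ _ tails))
    where
    coefficient : ∀ c cs → c ⊛ Z a ⊕ combination C cs · W a ≡ c
    coefficient c cs = begin
      c ⊛ Z a ⊕ combination C cs · W a             ≡⟨ ·-⊛-⊕ c (Z a) _ (W a) ⟩
      c ℙ.* (Z a · W a) ℙ.+ combination C cs · W a ≡⟨ cong₂ (λ x y → c ℙ.* x ℙ.+ y) d (combination-·-orthogonal C o cs) ⟩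
      c ℙ.* 1ℙ ℙ.+ 0ℙ                              ≡⟨ trans (ℙ.+-identityʳ _) (ℙ.*-identityʳ c) ⟩
      c                                            ∎
      where open ≡-Reasoning

    c≡c′ : c ≡ c′
    c≡c′ = trans (sym (coefficient c cs)) (trans (cong (_· W a) eq) (coefficient c′ cs′))

    tails : c ⊛ Z a ⊕ combination C cs ≡ c ⊛ Z a ⊕ combination C cs′
    tails = trans eq (cong (λ c → c ⊛ Z a ⊕ combination C cs′) (sym c≡c′))

  unitriangular⇒length≤ : ∀ C → All (λ a → Z a · W a ≡ 1ℙ) C → AllPairs (λ a b → Z b · W a ≡ 0ℙ) C →
                          length C ≤ D
  unitriangular⇒length≤ C diagonal below = Vec-Parity-↣⇒≤ (mk↣ (combination-injective C diagonal below))

-- Upper bound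

unit : Fin k → Vec Parity k
unit {k} i = replicate k 0ℙ [ i ]≔ 1ℙ

unit-· : (i : Fin k) (v : Vec Parity k) → unit i · v ≡ lookup v i
unit-· zero (y ∷ v) = trans (cong (y ℙ.+_) (·-zeroˡ v)) (ℙ.+-identityʳ y)
unit-· (suc i) (_ ∷ v) = unit-· i v

module Embedding (m : ℕ) where

  isZero : Fin (suc m) → Parity
  isZero zero = 1ℙ
  isZero (suc _) = 0ℙ

  zBlock wBlock : Fin (suc m) → Vec Parity m
  zBlock zero = replicate m 0ℙ
  zBlock (suc i) = unit i
  wBlock zero = replicate m 1ℙ
  wBlock (suc i) = unit i

  block-·-same : ∀ x → zBlock x · wBlock x ≡ 1ℙ ℙ.+ isZero x
  block-·-same zero = ·-zeroˡ (replicate m 1ℙ)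
  block-·-same (suc i) = trans (unit-· i (unit i)) (lookup∘update i (replicate m 0ℙ) 1ℙ)

  block-·-differ : ∀ {x y} → x ≢ y → zBlock x · wBlock y ≡ isZero y
  block-·-differ {zero} {zero} x≢y = contradiction refl x≢y
  block-·-differ {zero} {suc j} _ = ·-zeroˡ (unit j)
  block-·-differ {suc i} {zero} _ = trans (unit-· i (replicate m 1ℙ)) (lookup-replicate i 1ℙ)
  block-·-differ {suc i} {suc j} x≢y =
    trans (unit-· i (unit j)) (trans (lookup∘update′ (x≢y ∘ cong suc) (replicate m 0ℙ) 1ℙ) (lookup-replicate i 0ℙ))

  zeroParity : Vertex ℓ (suc m) → Parity
  zeroParity [] = 0ℙ
  zeroParity (x ∷ v) = isZero x ℙ.+ zeroParity v

  embedZ embedW : Vertex ℓ (suc m) → Vec Parity (ℓ * m)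
  embedZ [] = []
  embedZ (x ∷ u) = zBlock x ++ embedZ u
  embedW [] = []
  embedW (y ∷ v) = wBlock y ++ embedW v

  embed-· : (u v : Vertex ℓ (suc m)) → embedZ u · embedW v ≡ parity ℓ ℙ.+ diffParity u v ℙ.+ zeroParity v
  embed-· [] [] = refl
  embed-· {suc ℓ} (x ∷ u) (y ∷ v) with x ≟ y
  ... | yes refl = begin
    (zBlock x ++ embedZ u) · (wBlock x ++ embedW v) ≡⟨ ·-++ (zBlock x) (wBlock x) (embedZ u) (embedW v) ⟩
    zBlock x · wBlock x ℙ.+ embedZ u · embedW v    ≡⟨ cong₂ ℙ._+_ (block-·-same x) (embed-· u v) ⟩
    1ℙ ℙ.+ z ℙ.+ (a ℙ.+ d ℙ.+ p)                  ≡⟨ solve 4 (λ z a d p → con 1ℙ :+ z :+ (a :+ d :+ p)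
                                                                      := con 1ℙ :+ a :+ d :+ (z :+ p)) refl z a d p ⟩
    1ℙ ℙ.+ a ℙ.+ d ℙ.+ (z ℙ.+ p)                  ≡⟨ cong (λ a′ → a′ ℙ.+ d ℙ.+ (z ℙ.+ p)) (sym (ℙ.+-homo-+ 1 ℓ)) ⟩
    parity (suc ℓ) ℙ.+ d ℙ.+ (z ℙ.+ p)            ∎
    where
    open ≡-Reasoning
    z = isZero x ; a = parity ℓ ; d = diffParity u v ; p = zeroParity v
  ... | no x≢y = begin
    (zBlock x ++ embedZ u) · (wBlock y ++ embedW v)   ≡⟨ ·-++ (zBlock x) (wBlock y) (embedZ u) (embedW v) ⟩
    zBlock x · wBlock y ℙ.+ embedZ u · embedW v      ≡⟨ cong₂ ℙ._+_ (block-·-differ x≢y) (embed-· u v) ⟩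
    z ℙ.+ (a ℙ.+ d ℙ.+ p)                            ≡⟨ solve 4 (λ z a d p → z :+ (a :+ d :+ p)
                                                                        := con 1ℙ :+ a :+ (con 1ℙ :+ d) :+ (z :+ p)) refl z a d p ⟩
    1ℙ ℙ.+ a ℙ.+ (1ℙ ℙ.+ d) ℙ.+ (z ℙ.+ p)            ≡⟨ sym (cong₂ (λ a′ d′ → a′ ℙ.+ d′ ℙ.+ (z ℙ.+ p))
                                                                   (ℙ.+-homo-+ 1 ℓ) (ℙ.+-homo-+ 1 (diffCount u v))) ⟩
    parity (suc ℓ) ℙ.+ parity (suc (diffCount u v)) ℙ.+ (z ℙ.+ p) ∎
    where
    open ≡-Reasoning
    z = isZero y ; a = parity ℓ ; d = diffParity u v ; p = zeroParity v

  Z W : Vertex ℓ (suc m) → Vec Parity (suc (ℓ * m))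
  Z u = 1ℙ ∷ embedZ u
  W {ℓ} v = 1ℙ ℙ.+ parity ℓ ℙ.+ zeroParity v ∷ embedW v

  Z-·-W : (u v : Vertex ℓ (suc m)) → Z u · W v ≡ 1ℙ ℙ.+ diffParity u v
  Z-·-W {ℓ} u v =
    trans (cong (1ℙ ℙ.+ a ℙ.+ p ℙ.+_) (embed-· u v))
          (solve 3 (λ a d p → con 1ℙ :+ a :+ p :+ (a :+ d :+ p) := con 1ℙ :+ d) refl a (diffParity u v) p)
    where
    a = parity ℓ ; p = zeroParity v

  clique-length≤ : (C : List (Vertex ℓ (suc m))) → IsClique C → length C ≤ suc (ℓ * m)
  clique-length≤ C clique = unitriangular⇒length≤ Z W C diagonal (AllPairs.map below clique)
    where
    diagonal : All (λ u → Z u · W u ≡ 1ℙ) C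
    diagonal = All.universal (λ u → trans (Z-·-W u u) (cong (1ℙ ℙ.+_) (diffParity-refl u))) C

    below : ∀ {u v} → Adj u v → Z v · W u ≡ 0ℙ
    below {u} {v} adj =
      trans (Z-·-W v u) (cong (1ℙ ℙ.+_) (trans (diffParity-sym v u) (Adj⇒diffParity≡1ℙ adj)))

-- Lines and gluing

Adj-++ˡ : (w : Vertex k n) {u v : Vertex ℓ n} → Adj u v → Adj (w ++ u) (w ++ v)
Adj-++ˡ w {u} {v} adj = diffParity≡1ℙ⇒Adj (begin
  diffParity (w ++ u) (w ++ v)       ≡⟨ diffParity-++ w w u v ⟩
  diffParity w w ℙ.+ diffParity u v ≡⟨ cong₂ ℙ._+_ (diffParity-refl w) (Adj⇒diffParity≡1ℙ adj) ⟩
  1ℙ                                ∎)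
  where open ≡-Reasoning

Adj-++ʳ : (w : Vertex ℓ n) {u v : Vertex k n} → Adj u v → Adj (u ++ w) (v ++ w)
Adj-++ʳ w {u} {v} adj = diffParity≡1ℙ⇒Adj (begin
  diffParity (u ++ w) (v ++ w)       ≡⟨ diffParity-++ u v w w ⟩
  diffParity u v ℙ.+ diffParity w w ≡⟨ cong₂ ℙ._+_ (Adj⇒diffParity≡1ℙ adj) (diffParity-refl w) ⟩
  1ℙ                                ∎)
  where open ≡-Reasoning

join : Vertex k n → List (Vertex ℓ n) → Vertex ℓ n → List (Vertex k n) → List (Vertex (k + ℓ) n)
join z C t K = List.map (z ++_) C List.++ List.map (_++ t) K

length-join : (z : Vertex k n) (C : List (Vertex ℓ n)) (t : Vertex ℓ n) (K : List (Vertex k n)) →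
              length (join z C t K) ≡ length C + length K
length-join z C t K =
  trans (length-++ (List.map (z ++_) C)) (cong₂ _+_ (length-map (z ++_) C) (length-map (_++ t) K))

module _ {z : Vertex k n} {C : List (Vertex ℓ n)} {t : Vertex ℓ n} {K : List (Vertex k n)} {σ : Parity}
         (C-centred : All (λ c → diffParity t c ≡ σ) C) where

  join-isClique : IsClique C → IsClique K → All (λ v → diffParity z v ≡ σ ⁻¹) K → IsClique (join z C t K)
  join-isClique C-clique K-clique z-far =
    AllPairs.++⁺ (AllPairs.map⁺ (AllPairs.map (Adj-++ˡ z) C-clique))
                 (AllPairs.map⁺ (AllPairs.map (Adj-++ʳ t) K-clique))
                 (All.map⁺ (All.map (λ tc → All.map⁺ (All.map (across tc) z-far)) C-centred))
    where
    across : ∀ {c v} → diffParity t c ≡ σ → diffParity z v ≡ σ ⁻¹ → Adj (z ++ c) (v ++ t)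
    across {c} {v} tc zv = diffParity≡1ℙ⇒Adj (begin
      diffParity (z ++ c) (v ++ t)       ≡⟨ diffParity-++ z v c t ⟩
      diffParity z v ℙ.+ diffParity c t ≡⟨ cong₂ ℙ._+_ zv (trans (diffParity-sym c t) tc) ⟩
      σ ⁻¹ ℙ.+ σ                        ≡⟨ ℙ.p⁻¹+p≡1ℙ σ ⟩
      1ℙ                                ∎)
      where open ≡-Reasoning

  join-centred : ∀ z′ → All (λ v → diffParity z′ v ≡ σ) K → diffParity z′ z ≡ 0ℙ →
                 All (λ x → diffParity (z′ ++ t) x ≡ σ) (join z C t K)
  join-centred z′ z′-K z′z = All.++⁺ (All.map⁺ (All.map left C-centred)) (All.map⁺ (All.map right z′-K))
    where
    left : ∀ {c} → diffParity t c ≡ σ → diffParity (z′ ++ t) (z ++ c) ≡ σ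
    left {c} tc = trans (diffParity-++ z′ z t c) (cong₂ ℙ._+_ z′z tc)

    right : ∀ {v} → diffParity z′ v ≡ σ → diffParity (z′ ++ t) (v ++ t) ≡ σ
    right {v} z′v =
      trans (diffParity-++ z′ v t t) (trans (cong₂ ℙ._+_ z′v (diffParity-refl t)) (ℙ.+-identityʳ σ))

LinePattern : ℕ → ℕ → Set
LinePattern ℓ n = Vertex ℓ n × Fin (suc ℓ)

point : LinePattern ℓ n → Fin n → Vertex (suc ℓ) n
point (u , i) x = insertAt u i x

line : ∀ {a} → (Fin a → Fin n) → LinePattern ℓ n → List (Vertex (suc ℓ) n)
line f p = List.tabulate (point p ∘ f)

lines : ∀ {a} → (Fin a → Fin n) → List (LinePattern ℓ n) → List (Vertex (suc ℓ) n)
lines f [] = []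
lines f (p ∷ ps) = line f p List.++ lines f ps

module _ {a} (f : Fin a → Fin n) where

  line-isClique : (p : LinePattern ℓ n) → Injective _≡_ _≡_ f → IsClique (line f p)
  line-isClique (u , i) f-injective =
    AllPairs.tabulate⁺ (λ j≢j′ → Odd⇒Adj (subst Odd (sym (diffCount-insertAt u i (j≢j′ ∘ f-injective))) one))

  All-lines : {P : Vertex (suc ℓ) n → Set} (ps : List (LinePattern ℓ n)) →
              All (λ p → ∀ j → P (point p (f j))) ps → All P (lines f ps)
  All-lines [] [] = []
  All-lines (p ∷ ps) (Pp ∷ Pps) = All.++⁺ (All.tabulate⁺ Pp) (All-lines ps Pps)

  lines-isClique : (ps : List (LinePattern ℓ n)) → Injective _≡_ _≡_ f →
                   AllPairs (λ p q → ∀ j j′ → Odd (diffCount (point p (f j)) (point q (f j′)))) ps →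
                   IsClique (lines f ps)
  lines-isClique [] _ [] = []
  lines-isClique (p ∷ ps) f-injective (odd ∷ odds) =
    AllPairs.++⁺ (line-isClique p f-injective) (lines-isClique ps f-injective odds)
                 (All.tabulate⁺ λ j → All-lines ps (All.map (λ odd-q j′ → Odd⇒Adj (odd-q j j′)) odd))

  length-lines : (ps : List (LinePattern ℓ n)) → length (lines f ps) ≡ length ps * a
  length-lines [] = refl
  length-lines (p ∷ ps) = trans (length-++ (line f p)) (cong₂ _+_ (length-tabulate _) (length-lines ps))

-- Lower bound

module Construction (m : ℕ) where

  V : ℕ → Set
  V ℓ = Vertex ℓ (3 + m)

  record CentredClique (ℓ d : ℕ) : Set where
    field
      members : List (V ℓ)
      isClique : IsClique members
      centre : V ℓ
      centreParity : Parity
      centred : All (λ c → diffParity centre c ≡ centreParity) members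
      large : ℓ * suc m ≤ length members + d

  record Extender (k d : ℕ) : Set where
    field
      tip : V k
      members : List (V k)
      isClique : IsClique (tip ∷ members)
      centre : V k
      centred : All (λ v → diffParity centre v ≡ 0ℙ) (tip ∷ members)
      large : k * suc m ≤ length members + d

  record Anchors {k} (K : List (V k)) (σ : Parity) : Set where
    field
      far near : V k
      far-parity : All (λ v → diffParity far v ≡ σ ⁻¹) K
      near-parity : All (λ v → diffParity near v ≡ σ) K
      near-far : diffParity near far ≡ 0ℙ

  module _ {k d} (E : Extender k d) where
    open Extender E

    members-isClique : IsClique members
    members-isClique = AllPairs.tail isClique

    members-centred : All (λ v → diffParity centre v ≡ 0ℙ) members
    members-centred = All.tail centred

    anchors : ∀ σ → Anchors members σ
    anchors 0ℙ = record
      { far = tip ; near = centre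
      ; far-parity = All.map Adj⇒diffParity≡1ℙ (AllPairs.head isClique)
      ; near-parity = members-centred
      ; near-far = All.head centred
      }
    anchors 1ℙ = record
      { far = centre ; near = tip
      ; far-parity = members-centred
      ; near-parity = All.map Adj⇒diffParity≡1ℙ (AllPairs.head isClique)
      ; near-far = trans (diffParity-sym tip centre) (All.head centred)
      }

    toCentredClique : CentredClique k d
    toCentredClique = record
      { members = members ; isClique = members-isClique
      ; centre = centre ; centreParity = 0ℙ ; centred = members-centred
      ; large = large
      }

  weaken : ∀ {ℓ d d′} → d ≤ d′ → CentredClique ℓ d → CentredClique ℓ d′
  weaken d≤d′ S = record { CentredClique S ; large = ≤-trans (CentredClique.large S) (+-monoʳ-≤ _ d≤d′) }

  extend : ∀ {ℓ d k d′} → CentredClique ℓ d → Extender k d′ → CentredClique (k + ℓ) (d + d′)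
  extend {ℓ} {d} {k} {d′} S E = record
    { members = join far S.members S.centre E.members
    ; isClique = join-isClique S.centred S.isClique (members-isClique E) far-parity
    ; centre = near ++ S.centre
    ; centreParity = S.centreParity
    ; centred = join-centred S.centred near near-parity near-far
    ; large = begin
        (k + ℓ) * suc m                                  ≡⟨ *-distribʳ-+ (suc m) k ℓ ⟩
        k * suc m + ℓ * suc m                            ≤⟨ +-mono-≤ E.large S.large ⟩
        (length E.members + d′) + (length S.members + d) ≡⟨ regroup (length E.members) d′ (length S.members) d ⟩
        (length S.members + length E.members) + (d + d′) ≡⟨ cong (_+ (d + d′)) (sym (length-join far S.members S.centre E.members)) ⟩
        length (join far S.members S.centre E.members) + (d + d′) ∎
    }
    where
    module S = CentredClique S
    module E = Extender E
    open Anchors (anchors E S.centreParity)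
    open ≤-Reasoning

    regroup : ∀ a b c e → (a + b) + (c + e) ≡ (c + a) + (e + b)
    regroup = solve-∀

  g : Fin (suc m) → Fin (3 + m)
  g = 2 ↑ʳ_

  g-injective : Injective _≡_ _≡_ g
  g-injective = ↑ʳ-injective 2 _ _

  odd₃ : Odd 3
  odd₃ = s-s one

  tripodPatterns : List (LinePattern 2 (3 + m))
  tripodPatterns = (0F ∷ 0F ∷ [] , 0F) ∷ (0F ∷ 1F ∷ [] , 1F) ∷ (1F ∷ 1F ∷ [] , 2F) ∷ []

  tripod : List (V 3)
  tripod = lines g tripodPatterns

  tripod-isClique : IsClique tripod
  tripod-isClique = lines-isClique g tripodPatterns g-injective
    (((λ _ _ → odd₃) ∷ (λ _ _ → odd₃) ∷ []) ∷ ((λ _ _ → odd₃) ∷ []) ∷ [] ∷ [])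

  tripod-centre : V 3
  tripod-centre = 0F ∷ 1F ∷ 0F ∷ []

  tripod-centred : All (λ v → diffParity tripod-centre v ≡ 0ℙ) tripod
  tripod-centred = All-lines g tripodPatterns ((λ _ → refl) ∷ (λ _ → refl) ∷ (λ _ → refl) ∷ [])

  tripodClique : CentredClique 3 0
  tripodClique = record
    { members = tripod
    ; isClique = tripod-isClique
    ; centre = tripod-centre
    ; centreParity = 0ℙ
    ; centred = tripod-centred
    ; large = ≤-reflexive (trans (sym (length-lines g tripodPatterns)) (sym (+-identityʳ _)))
    }

  -- tip ∷ members is the tripod itself, whose first point is (2,0,0).
  tripodExtender : Extender 3 1
  tripodExtender = record
    { tip = 2F ∷ 0F ∷ 0F ∷ []
    ; members = List.drop 1 tripod
    ; isClique = tripod-isClique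
    ; centre = tripod-centre
    ; centred = tripod-centred
    ; large = ≤-reflexive (trans (sym (length-lines g tripodPatterns)) (+-comm 1 _))
    }

  tetrapodPatterns : List (LinePattern 3 (3 + m))
  tetrapodPatterns =
    (1F ∷ 0F ∷ 0F ∷ [] , 0F) ∷ (0F ∷ 1F ∷ 0F ∷ [] , 1F) ∷ (1F ∷ 0F ∷ 0F ∷ [] , 2F) ∷ (1F ∷ 1F ∷ 1F ∷ [] , 3F) ∷ []

  tetrapod : List (V 4)
  tetrapod = lines g tetrapodPatterns

  tetrapod-isClique : IsClique tetrapod
  tetrapod-isClique = lines-isClique g tetrapodPatterns g-injective
    (((λ _ _ → odd₃) ∷ (λ _ _ → odd₃) ∷ (λ _ _ → odd₃) ∷ [])
     ∷ ((λ _ _ → odd₃) ∷ (λ _ _ → odd₃) ∷ [])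
     ∷ ((λ _ _ → odd₃) ∷ [])
     ∷ []
     ∷ [])

  tetrapodExtender : Extender 4 0
  tetrapodExtender = record
    { tip = 1F ∷ 1F ∷ 1F ∷ 1F ∷ []
    ; members = tetrapod
    ; isClique = All-lines g tetrapodPatterns
                   ((λ _ → Odd⇒Adj odd₃) ∷ (λ _ → Odd⇒Adj odd₃) ∷ (λ _ → Odd⇒Adj odd₃) ∷ (λ _ → Odd⇒Adj one) ∷ [])
                 ∷ tetrapod-isClique
    ; centre = 0F ∷ 0F ∷ 0F ∷ 0F ∷ []
    ; centred = refl ∷ All-lines g tetrapodPatterns ((λ _ → refl) ∷ (λ _ → refl) ∷ (λ _ → refl) ∷ (λ _ → refl) ∷ [])
    ; large = ≤-reflexive (trans (sym (length-lines g tetrapodPatterns)) (sym (+-identityʳ _)))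
    }

  nonzeroLine : CentredClique 1 0
  nonzeroLine = record
    { members = lines suc (([] , 0F) ∷ [])
    ; isClique = lines-isClique suc (([] , 0F) ∷ []) suc-injective ([] ∷ [])
    ; centre = 0F ∷ []
    ; centreParity = 1ℙ
    ; centred = All-lines suc (([] , 0F) ∷ []) ((λ _ → refl) ∷ [])
    ; large = ≤-trans (n≤1+n (1 * suc m))
                (≤-trans (m≤m+n _ 0) (≤-reflexive (cong (_+ 0) (sym (length-lines suc (([] , 0F) ∷ []))))))
    }

  largeClique : ∀ ℓ → CentredClique (3 + ℓ) 1
  largeClique 0 = weaken z≤n tripodClique
  largeClique 1 = weaken z≤n (toCentredClique tetrapodExtender)
  largeClique 2 = weaken z≤n (extend nonzeroLine tetrapodExtender)
  largeClique 3 = extend tripodClique tripodExtender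
  largeClique (suc (suc (suc (suc ℓ)))) = extend (largeClique ℓ) tetrapodExtender

lower-bound-trivial : ∀ ℓ {n} k → n ≤ 2 → ℓ * n ≤ k + 2 * ℓ + 1
lower-bound-trivial ℓ {n} k n≤2 = begin
  ℓ * n          ≤⟨ *-monoʳ-≤ ℓ n≤2 ⟩
  ℓ * 2          ≡⟨ *-comm ℓ 2 ⟩
  2 * ℓ          ≤⟨ m≤n+m (2 * ℓ) k ⟩
  k + 2 * ℓ      ≤⟨ m≤m+n (k + 2 * ℓ) 1 ⟩
  k + 2 * ℓ + 1  ∎
  where open ≤-Reasoning

clique-number-lower : ∀ ℓ n {k} → 3 ≤ ℓ → IsCliqueNumber ℓ n k → ℓ * n ≤ k + 2 * ℓ + 1
clique-number-lower ℓ 0 {k} _ _ = lower-bound-trivial ℓ k z≤n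
clique-number-lower ℓ 1 {k} _ _ = lower-bound-trivial ℓ k (s≤s z≤n)
clique-number-lower ℓ 2 {k} _ _ = lower-bound-trivial ℓ k (s≤s (s≤s z≤n))
clique-number-lower ℓ@(suc (suc (suc ℓ′))) (suc (suc (suc m))) {k} (s≤s (s≤s (s≤s _))) (_ , maximal) = begin
  ℓ * (3 + m)                  ≡⟨ split ℓ m ⟩
  2 * ℓ + ℓ * suc m            ≤⟨ +-monoʳ-≤ (2 * ℓ) large ⟩
  2 * ℓ + (length members + 1) ≤⟨ +-monoʳ-≤ (2 * ℓ) (+-monoˡ-≤ 1 (maximal members isClique)) ⟩
  2 * ℓ + (k + 1)              ≡⟨ regroup (2 * ℓ) k ⟩
  k + 2 * ℓ + 1                ∎
  where
  open Construction.CentredClique (Construction.largeClique m ℓ′)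
  open ≤-Reasoning

  split : ∀ a m → a * (3 + m) ≡ 2 * a + a * suc m
  split = solve-∀

  regroup : ∀ a c → a + (c + 1) ≡ c + a + 1
  regroup = solve-∀

clique-number-upper : ∀ ℓ m {k} → IsCliqueNumber ℓ (suc m) k → k + ℓ ≤ ℓ * suc m + 1
clique-number-upper ℓ m ((C , C-clique , refl) , _) = begin
  length C + ℓ    ≤⟨ +-monoˡ-≤ ℓ (Embedding.clique-length≤ m C C-clique) ⟩
  suc (ℓ * m) + ℓ ≡⟨ regroup ℓ m ⟩
  ℓ * suc m + 1   ∎
  where
  open ≤-Reasoning

  regroup : ∀ a m → suc (a * m) + a ≡ a * suc m + 1
  regroup = solve-∀

theorem1p2 : ∀ (ℓ n : ℕ) → 3 ≤ ℓ → 1 ≤ n →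
    ∃ λ k → IsCliqueNumber ℓ n k
      × (ℓ * n ≤ k + 2 * ℓ + 1)
      × (k + ℓ ≤ ℓ * n + 1)
theorem1p2 ℓ (suc m) ℓ≥3 _
  with k , ω ← clique-number-exists ℓ (suc m) (suc (ℓ * m)) (Embedding.clique-length≤ m)
  = k , ω , clique-number-lower ℓ (suc m) ℓ≥3 ω , clique-number-upper ℓ m ω
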